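{- Let $G$ be a transitive permutation group on a finite set $X$ and $H$ a transitive permutation group on a finite set $Y$, and let $\mathcal{B}$ be the $(G\wr H)$-invariant partition of $X\times Y$ formed by the orbits of $1_G\wr H$. If $\mathcal{C}$ is any $(G\wr H)$-invariant partition of $X\times Y$, then either $\mathcal{B}\preceq\mathcal{C}$ or $\mathcal{C}\preceq\mathcal{B}$. Consequently, $\mathcal{B}$ is the only $(G\wr H)$-invariant partition of $X\times Y$ whose blocks have size $|Y|$ (the degree of $H$).
   Context: For a permutation group $G$ on $X$ and a permutation group $H$ on $Y$, the wreath product $G\wr H$ is the group of all permutations $f$ of $X\times Y$ for which there exist $g\in G$ and, for each $x\in X$, an element $h_x\in H$ such that $f((x,y))=(g(x),h_x(y))$ for all $(x,y)$. The subgroup $1_G\wr H$ consists of those $f$ with $g=1_G$; its orbits are the sets $\{x\}\times Y$. For a transitive group $K$ on a set $Z$, a block is a subset $B\subseteq Z$ such that for every $k\in K$, $k(B)\cap B\in\{\emptyset,B\}$; the set of all images $k(B)$, $k\in K$, of a block $B$ is a partition of $Z$, called a $K$-invariant partition. For $K$-invariant partitions $\mathcal{C},\mathcal{B}$, write $\mathcal{C}\preceq\mathcal{B}$ if every block of $\mathcal{C}$ is contained in some block of $\mathcal{B}$. -}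

module Defs where

open import Level using (0ℓ)
open import Data.Nat using (ℕ; _+_)
open import Data.Bool using (Bool; true; false; _∧_; if_then_else_)
open import Data.Fin using (Fin)
open import Data.Fin.Properties using () renaming (_≟_ to _≟ᶠ_)
open import Data.List using (List; map; concatMap; allFin)
open import Data.Nat.ListAction using (sum)
open import Data.Product using (_×_; _,_; Σ; ∃; ∃-syntax; proj₁; proj₂)
open import Data.Sum using (_⊎_)
open import Relation.Nullary.Decidable using (⌊_⌋)
open import Relation.Binary.PropositionalEquality using (_≡_)
open import Function.Bundles using (_↔_; Inverse)
open import Function.Construct.Identity using (↔-id)
open import Function.Construct.Composition using (_↔-∘_)
open import Function.Construct.Symmetry using (↔-sym)

Perm : Set → Set
Perm A = A ↔ A

_⟨$⟩_ : {A : Set} → Perm A → A → A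
σ ⟨$⟩ a = Inverse.to σ a

_⟨$⟩⁻¹_ : {A : Set} → Perm A → A → A
σ ⟨$⟩⁻¹ a = Inverse.from σ a

infixr 9 _⟨$⟩_ _⟨$⟩⁻¹_

record PermGroup (A : Set) : Set₁ where
  field
    mem    : Perm A → Set
    ∈-resp : ∀ {σ τ} → (∀ a → σ ⟨$⟩ a ≡ τ ⟨$⟩ a) → mem σ → mem τ
    id-∈   : mem (↔-id A)
    ∘-∈    : ∀ {σ τ} → mem σ → mem τ → mem (σ ↔-∘ τ)
    inv-∈  : ∀ {σ} → mem σ → mem (↔-sym σ)

open PermGroup public

_∈_ : {A : Set} → Perm A → PermGroup A → Set
g ∈ G = mem G g

Transitive : {A : Set} → PermGroup A → Set
Transitive {A} G = ∀ (a b : A) → ∃[ g ] (g ∈ G × g ⟨$⟩ a ≡ b)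

_≀_ : {X Y : Set} → PermGroup X → PermGroup Y → Perm (X × Y) → Set
_≀_ {X} {Y} G H f =
  ∃[ g ] (g ∈ G ×
    Σ (X → Perm Y) λ h → ((∀ (x : X) → h x ∈ H) ×
      (∀ (x : X) (y : Y) → f ⟨$⟩ (x , y) ≡ (g ⟨$⟩ x , h x ⟨$⟩ y))))

Subset : Set → Set
Subset Z = Z → Bool

_⊆_ : {Z : Set} → Subset Z → Subset Z → Set
B ⊆ C = ∀ z → B z ≡ true → C z ≡ true

_≐_ : {Z : Set} → Subset Z → Subset Z → Set
B ≐ C = ∀ z → B z ≡ C z

image : {Z : Set} → Perm Z → Subset Z → Subset Z
image k B z = B (k ⟨$⟩⁻¹ z)

NonEmpty : {Z : Set} → Subset Z → Set
NonEmpty B = ∃[ z ] (B z ≡ true)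

IsBlock : {Z : Set} → (Perm Z → Set) → Subset Z → Set
IsBlock K B = ∀ k → K k →
  (∀ z → (image k B z ∧ B z) ≡ false) ⊎ (image k B ≐ B)

-- Partitions are represented as families of blocks, i.e. predicates on
-- subsets. The K-invariant partition generated by a block B is
-- { k(B) | k ∈ K } (taken up to extensional equality of subsets).

Family : Set → Set₁
Family Z = Subset Z → Set

IsInvariantPartition : {Z : Set} → (Perm Z → Set) → Family Z → Set
IsInvariantPartition {Z} K P =
  ∃[ B ] (NonEmpty B × IsBlock K B ×
    (∀ (S : Subset Z) → (P S → ∃[ k ] (K k × S ≐ image k B))
                      × (∃[ k ] (K k × S ≐ image k B) → P S)))

_⪯_ : {Z : Set} → Family Z → Family Z → Set
C ⪯ B = ∀ S → C S → ∃[ T ] (B T × S ⊆ T)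

_≡ₚ_ : {Z : Set} → Family Z → Family Z → Set
P ≡ₚ Q = (∀ S → P S → ∃[ T ] (Q T × S ≐ T))
       × (∀ T → Q T → ∃[ S ] (P S × S ≐ T))

-- the partition of X × Y into the sets {x} × Y
-- (the orbits of 1_G ≀ H when H is transitive)
fibres : (m n : ℕ) → Family (Fin m × Fin n)
fibres m n S = ∃[ x ] (S ≐ (λ z → ⌊ proj₁ z ≟ᶠ x ⌋))

card : {m n : ℕ} → Subset (Fin m × Fin n) → ℕ
card {m} {n} S =
  sum (map (λ z → if S z then 1 else 0)
           (concatMap (λ x → map (x ,_) (allFin n)) (allFin m)))

-- A block B of G ≀ H through (x₀ , y₀) either stays inside the fibre {x₀} × Y or
-- contains it: if B also meets a point (x₁ , y₁) with x₁ ≠ x₀, the wreath element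
-- acting as h ∈ H on the fibre of x₀ and trivially elsewhere fixes (x₁ , y₁), so it
-- maps B to itself, and by transitivity of H it carries (x₀ , y₀) to any (x₀ , y).
-- Since G ≀ H permutes the fibres, and G does so transitively, the two cases give
-- C ⪯ fibres resp. fibres ⪯ C. A block of size |Y| cannot be strictly smaller or
-- strictly larger than a fibre, so it is a fibre.
module Submission where

open import Defs
open import Data.Nat using (ℕ; suc; _+_; _*_; _≤_; _<_; z≤n; s≤s)
open import Data.Nat.Properties
  using (≤-refl; +-mono-≤; +-mono-≤-<; <-irrefl; *-zeroʳ; *-suc; *-distribʳ-+; *-identityˡ)
open import Data.Bool using (Bool; true; false; _∧_; if_then_else_)
import Data.Bool.Properties as Bool
open import Data.Fin using (Fin) renaming (zero to fzero; suc to fsuc)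
open import Data.Fin.Properties using (any?; suc-injective) renaming (_≟_ to _≟ᶠ_)
open import Data.Product using (_×_; _,_; ∃-syntax; proj₁; proj₂)
open import Data.Sum using (_⊎_; inj₁; inj₂)
open import Data.Empty using (⊥-elim)
open import Data.List using (List; []; _∷_; _++_; map; concatMap; tabulate; allFin; length; cartesianProduct)
open import Data.List.Properties using (map-++; map-∘; map-cong; map-tabulate; length-tabulate)
open import Data.List.Membership.Propositional using () renaming (_∈_ to _∈ₗ_)
open import Data.List.Membership.Propositional.Properties using (∈-cartesianProduct⁺; ∈-allFin)
open import Data.List.Relation.Unary.Any using (here; there)
open import Data.Nat.ListAction using (sum)
open import Data.Nat.ListAction.Properties using (sum-++)
open import Relation.Nullary using (yes; no; _×-dec_; ¬?)
open import Relation.Nullary.Decidable using (Dec; ⌊_⌋; isYes≗does; does-⇔; ⌊⌋-map′; decidable-stable)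
open import Relation.Binary.Definitions using (DecidableEquality)
open import Relation.Binary.PropositionalEquality
  using (_≡_; _≢_; refl; sym; trans; cong; cong₂; module ≡-Reasoning)
open import Function using (_∘_)
open import Function.Bundles using (Inverse; _⇔_; mk↔ₛ′; mk⇔)
open import Function.Construct.Identity using (↔-id)

⟨$⟩-injective : {A : Set} (σ : Perm A) {a b : A} → σ ⟨$⟩ a ≡ σ ⟨$⟩ b → a ≡ b
⟨$⟩-injective σ {a} {b} e = begin
  a                   ≡⟨ sym (Inverse.strictlyInverseʳ σ a) ⟩
  σ ⟨$⟩⁻¹ σ ⟨$⟩ a     ≡⟨ cong (σ ⟨$⟩⁻¹_) e ⟩
  σ ⟨$⟩⁻¹ σ ⟨$⟩ b     ≡⟨ Inverse.strictlyInverseʳ σ b ⟩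
  b                   ∎
  where open ≡-Reasoning

⌊⌋-⇔ : {A B : Set} → A ⇔ B → (a? : Dec A) (b? : Dec B) → ⌊ a? ⌋ ≡ ⌊ b? ⌋
⌊⌋-⇔ A⇔B a? b? = trans (isYes≗does a?) (trans (does-⇔ A⇔B a? b?) (sym (isYes≗does b?)))

wreath : {X Y : Set} → Perm X → (X → Perm Y) → Perm (X × Y)
wreath g h = mk↔ₛ′ to from to∘from from∘to
  where
  to from : _ × _ → _ × _
  to   (x , y) = g ⟨$⟩ x , h x ⟨$⟩ y
  from (x , y) = g ⟨$⟩⁻¹ x , h (g ⟨$⟩⁻¹ x) ⟨$⟩⁻¹ y
  to∘from : ∀ z → to (from z) ≡ z
  to∘from (x , y) = cong₂ _,_ (Inverse.strictlyInverseˡ g x)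
                              (Inverse.strictlyInverseˡ (h (g ⟨$⟩⁻¹ x)) y)
  from∘to : ∀ z → from (to z) ≡ z
  from∘to (x , y) rewrite Inverse.strictlyInverseʳ g x =
    cong (x ,_) (Inverse.strictlyInverseʳ (h x) y)

module _ {X Y : Set} (G : PermGroup X) (H : PermGroup Y) where

  wreath-∈ : ∀ {g h} → g ∈ G → (∀ x → h x ∈ H) → (G ≀ H) (wreath g h)
  wreath-∈ {g} {h} g∈G h∈H = g , g∈G , h , h∈H , λ _ _ → refl

  ≀-id : (G ≀ H) (↔-id (X × Y))
  ≀-id = ↔-id X , id-∈ G , (λ _ → ↔-id Y) , (λ _ → id-∈ H) , λ _ _ → refl

module _ {Z : Set} {S T : Subset Z} where

  ⊆-antisym : S ⊆ T → T ⊆ S → S ≐ T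
  ⊆-antisym S⊆T T⊆S z with S z in Sz | T z in Tz
  ... | true  | true  = refl
  ... | false | false = refl
  ... | true  | false = sym (trans (sym Tz) (S⊆T z Sz))
  ... | false | true  = trans (sym Sz) (T⊆S z Tz)

  image-mono : (k : Perm Z) → S ⊆ T → image k S ⊆ image k T
  image-mono k S⊆T z = S⊆T (k ⟨$⟩⁻¹ z)

  ≐-sym : S ≐ T → T ≐ S
  ≐-sym S≐T z = sym (S≐T z)

Orbit : {Z : Set} → (Perm Z → Set) → Subset Z → Family Z
Orbit K B S = ∃[ k ] (K k × S ≐ image k B)

IsOrbitOf : {Z : Set} → Family Z → (Perm Z → Set) → Subset Z → Set
IsOrbitOf C K B = ∀ S → (C S → Orbit K B S) × (Orbit K B S → C S)

module Fibres {X : Set} (_≟_ : DecidableEquality X) {Y : Set} where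

  fibre : X → Subset (X × Y)
  fibre x z = ⌊ proj₁ z ≟ x ⌋

  fibrePartition : Family (X × Y)
  fibrePartition S = ∃[ x ] (S ≐ fibre x)

  fibre-true : ∀ {x z} → fibre x z ≡ true → proj₁ z ≡ x
  fibre-true {x} {z} _ with proj₁ z ≟ x
  fibre-true         _  | yes p = p
  fibre-true         () | no _

  fibre-∋ : ∀ {x z} → proj₁ z ≡ x → fibre x z ≡ true
  fibre-∋ {x} {z} z₁≡x with proj₁ z ≟ x
  ... | yes _    = refl
  ... | no z₁≢x = ⊥-elim (z₁≢x z₁≡x)

  image-fibre : ∀ k g (h : X → Perm Y) →
    (∀ x y → k ⟨$⟩ (x , y) ≡ (g ⟨$⟩ x , h x ⟨$⟩ y)) →
    ∀ x → image k (fibre x) ≐ fibre (g ⟨$⟩ x)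
  image-fibre k g h k≡ x z =
    ⌊⌋-⇔ (mk⇔ (trans z≡ ∘ cong (g ⟨$⟩_)) (⟨$⟩-injective g ∘ trans (sym z≡)))
         (proj₁ w ≟ x) (proj₁ z ≟ (g ⟨$⟩ x))
    where
    w : X × Y
    w = k ⟨$⟩⁻¹ z
    z≡ : proj₁ z ≡ g ⟨$⟩ proj₁ w
    z≡ = trans (cong proj₁ (sym (Inverse.strictlyInverseˡ k z)))
               (cong proj₁ (k≡ (proj₁ w) (proj₂ w)))

  liftAt : X → Perm Y → X → Perm Y
  liftAt x₀ h x with x ≟ x₀
  ... | yes _ = h
  ... | no _  = ↔-id Y

  liftAt-self : ∀ x₀ h → liftAt x₀ h x₀ ≡ h
  liftAt-self x₀ h with x₀ ≟ x₀
  ... | yes _   = refl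
  ... | no x≢x = ⊥-elim (x≢x refl)

  liftAt-other : ∀ {x₀ x} h → x ≢ x₀ → liftAt x₀ h x ≡ ↔-id Y
  liftAt-other {x₀} {x} h x≢x₀ with x ≟ x₀
  ... | yes x≡x₀ = ⊥-elim (x≢x₀ x≡x₀)
  ... | no _     = refl

  module _ (G : PermGroup X) (H : PermGroup Y) where

    ≀-image-fibre : ∀ k → (G ≀ H) k → ∀ x → ∃[ x′ ] (image k (fibre x) ≐ fibre x′)
    ≀-image-fibre k (g , _ , h , _ , k≡) x = g ⟨$⟩ x , image-fibre k g h k≡ x

    fibre-as-image : Transitive G → ∀ x x′ → ∃[ k ] ((G ≀ H) k × fibre x′ ≐ image k (fibre x))
    fibre-as-image trG x x′ with trG x x′
    ... | g , g∈G , gx≡x′ =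
      wreath g (λ _ → ↔-id Y) , wreath-∈ G H g∈G (λ _ → id-∈ H) , λ z →
        sym (trans (image-fibre (wreath g (λ _ → ↔-id Y)) g (λ _ → ↔-id Y) (λ _ _ → refl) x z)
                   (cong (λ c → ⌊ proj₁ z ≟ c ⌋) gx≡x′))

    liftAt-∈ : ∀ {h} → h ∈ H → ∀ x₀ x → liftAt x₀ h x ∈ H
    liftAt-∈ h∈H x₀ x with x ≟ x₀
    ... | yes _ = h∈H
    ... | no _  = id-∈ H

    liftAt-stabilises-block : ∀ {B} → IsBlock (G ≀ H) B → ∀ {h} → h ∈ H →
      ∀ {x₀ x₁ y₁} → B (x₁ , y₁) ≡ true → x₁ ≢ x₀ →
      image (wreath (↔-id X) (liftAt x₀ h)) B ≐ B
    liftAt-stabilises-block {B} B-block {h} h∈H {x₀} {x₁} {y₁} B∋₁ x₁≢x₀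
      with B-block (wreath (↔-id X) (liftAt x₀ h)) (wreath-∈ G H (id-∈ G) (liftAt-∈ h∈H x₀))
    ... | inj₂ kB≐B     = kB≐B
    ... | inj₁ disjoint = ⊥-elim (Bool.not-¬ kB∩B∋₁ (disjoint (x₁ , y₁)))
      where
      kB∩B∋₁ : (B (x₁ , liftAt x₀ h x₁ ⟨$⟩⁻¹ y₁) ∧ B (x₁ , y₁)) ≡ true
      kB∩B∋₁ rewrite liftAt-other h x₁≢x₀ | B∋₁ = refl

    fibre⊆block : Transitive H → ∀ {B} → IsBlock (G ≀ H) B →
      ∀ {x₀ y₀ x₁ y₁} → B (x₀ , y₀) ≡ true → B (x₁ , y₁) ≡ true → x₁ ≢ x₀ →
      fibre x₀ ⊆ B
    fibre⊆block trH {B} B-block {x₀} {y₀} B∋₀ B∋₁ x₁≢x₀ (x , y) xy∈F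
      with fibre-true {z = x , y} xy∈F | trH y₀ y
    ... | refl | h , h∈H , hy₀≡y = begin
      B (x₀ , y)                           ≡⟨ liftAt-stabilises-block B-block h∈H B∋₁ x₁≢x₀ (x₀ , y) ⟨
      B (x₀ , liftAt x₀ h x₀ ⟨$⟩⁻¹ y)      ≡⟨ cong (λ σ → B (x₀ , σ ⟨$⟩⁻¹ y)) (liftAt-self x₀ h) ⟩
      B (x₀ , h ⟨$⟩⁻¹ y)                   ≡⟨ cong (λ y′ → B (x₀ , h ⟨$⟩⁻¹ y′)) hy₀≡y ⟨
      B (x₀ , h ⟨$⟩⁻¹ h ⟨$⟩ y₀)            ≡⟨ cong (λ y′ → B (x₀ , y′)) (Inverse.strictlyInverseʳ h y₀) ⟩
      B (x₀ , y₀)                          ≡⟨ B∋₀ ⟩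
      true                                 ∎
      where open ≡-Reasoning

  module _ (G : PermGroup X) (H : PermGroup Y) {C : Family (X × Y)} {B : Subset (X × Y)}
           (C-orbit : IsOrbitOf C (G ≀ H) B) {x₀ : X} where

    ⊆fibre⇒⪯fibrePartition : B ⊆ fibre x₀ → C ⪯ fibrePartition
    ⊆fibre⇒⪯fibrePartition B⊆F S S∈C with proj₁ (C-orbit S) S∈C
    ... | k , k∈G≀H , S≐kB with ≀-image-fibre G H k k∈G≀H x₀
    ... | x , kF≐F = fibre x , (x , λ _ → refl) , λ z z∈S →
      trans (sym (kF≐F z)) (image-mono k B⊆F z (trans (sym (S≐kB z)) z∈S))

    fibre⊆⇒fibrePartition⪯ : Transitive G → fibre x₀ ⊆ B → fibrePartition ⪯ C
    fibre⊆⇒fibrePartition⪯ trG F⊆B T (x , T≐F) with fibre-as-image G H trG x₀ x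
    ... | k , k∈G≀H , F≐kF = image k B , proj₂ (C-orbit (image k B)) (k , k∈G≀H , λ _ → refl) ,
      λ z z∈T → image-mono k F⊆B z (trans (sym (F≐kF z)) (trans (sym (T≐F z)) z∈T))

    ≐fibre⇒≡ₚfibrePartition : Transitive G → B ≐ fibre x₀ → C ≡ₚ fibrePartition
    ≐fibre⇒≡ₚfibrePartition trG B≐F = members-are-fibres , fibres-are-members
      where
      members-are-fibres : ∀ S → C S → ∃[ T ] (fibrePartition T × S ≐ T)
      members-are-fibres S S∈C with proj₁ (C-orbit S) S∈C
      ... | k , k∈G≀H , S≐kB with ≀-image-fibre G H k k∈G≀H x₀
      ... | x , kF≐F = fibre x , (x , λ _ → refl) , λ z →
        trans (S≐kB z) (trans (B≐F (k ⟨$⟩⁻¹ z)) (kF≐F z))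
      fibres-are-members : ∀ T → fibrePartition T → ∃[ S ] (C S × S ≐ T)
      fibres-are-members T (x , T≐F) with fibre-as-image G H trG x₀ x
      ... | k , k∈G≀H , F≐kF = image k B , proj₂ (C-orbit (image k B)) (k , k∈G≀H , λ _ → refl) ,
        λ z → trans (B≐F (k ⟨$⟩⁻¹ z)) (trans (sym (F≐kF z)) (sym (T≐F z)))

indicator : Bool → ℕ
indicator b = if b then 1 else 0

count : {A : Set} → (A → Bool) → List A → ℕ
count P xs = sum (map (indicator ∘ P) xs)

module _ {A : Set} where

  count-++ : ∀ (P : A → Bool) xs ys → count P (xs ++ ys) ≡ count P xs + count P ys
  count-++ P xs ys = trans (cong sum (map-++ (indicator ∘ P) xs ys))
                           (sum-++ (map (indicator ∘ P) xs) (map (indicator ∘ P) ys))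

  count-cong : ∀ {P Q : A → Bool} → (∀ a → P a ≡ Q a) → ∀ xs → count P xs ≡ count Q xs
  count-cong P≗Q xs = cong sum (map-cong (cong indicator ∘ P≗Q) xs)

  count-map : ∀ {B : Set} (P : B → Bool) (f : A → B) xs → count P (map f xs) ≡ count (P ∘ f) xs
  count-map P f xs = cong sum (sym (map-∘ xs))

  count-const : ∀ b (xs : List A) → count (λ _ → b) xs ≡ indicator b * length xs
  count-const b []       = sym (*-zeroʳ (indicator b))
  count-const b (x ∷ xs) = trans (cong (indicator b +_) (count-const b xs))
                                 (sym (*-suc (indicator b) (length xs)))

  indicator-mono : ∀ {P Q : A → Bool} → P ⊆ Q → ∀ a → indicator (P a) ≤ indicator (Q a)
  indicator-mono {P} {Q} P⊆Q a with P a in Pa | Q a in Qa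
  ... | false | _     = z≤n
  ... | true  | true  = ≤-refl
  ... | true  | false with () ← trans (sym (P⊆Q a Pa)) Qa

  count-mono : ∀ {P Q : A → Bool} → P ⊆ Q → ∀ xs → count P xs ≤ count Q xs
  count-mono P⊆Q []       = z≤n
  count-mono P⊆Q (a ∷ xs) = +-mono-≤ (indicator-mono P⊆Q a) (count-mono P⊆Q xs)

  count-mono-< : ∀ {P Q : A → Bool} → P ⊆ Q → ∀ {a xs} → a ∈ₗ xs → P a ≡ false → Q a ≡ true →
    count P xs < count Q xs
  count-mono-< P⊆Q {xs = _ ∷ xs} (here refl) Pa Qa rewrite Pa | Qa =
    s≤s (count-mono P⊆Q xs)
  count-mono-< P⊆Q {xs = b ∷ _} (there a∈xs) Pa Qa =
    +-mono-≤-< (indicator-mono P⊆Q b) (count-mono-< P⊆Q a∈xs Pa Qa)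

  count-≡⇒⊇ : ∀ {P Q : A → Bool} → P ⊆ Q → ∀ {xs} → count P xs ≡ count Q xs →
    ∀ a → a ∈ₗ xs → Q a ≡ true → P a ≡ true
  count-≡⇒⊇ {P} P⊆Q count≡ a a∈xs Qa with P a in Pa
  ... | true  = refl
  ... | false = ⊥-elim (<-irrefl count≡ (count-mono-< P⊆Q a∈xs Pa Qa))

count-tabulate : ∀ {A : Set} {k} (P : A → Bool) (f : Fin k → A) → count P (tabulate f) ≡ count (P ∘ f) (allFin k)
count-tabulate P f = trans (cong (count P) (sym (map-tabulate (λ x → x) f))) (count-map P f (allFin _))

count-≟-allFin : ∀ {k} (x₀ : Fin k) → count (λ x → ⌊ x ≟ᶠ x₀ ⌋) (allFin k) ≡ 1
count-≟-allFin {suc k} fzero =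
  cong suc (trans (count-tabulate (λ x → ⌊ x ≟ᶠ fzero {k} ⌋) fsuc) (count-const false (allFin k)))
count-≟-allFin {suc k} (fsuc x₀) = begin
  count (λ x → ⌊ x ≟ᶠ fsuc x₀ ⌋) (tabulate fsuc) ≡⟨ count-tabulate (λ x → ⌊ x ≟ᶠ fsuc x₀ ⌋) fsuc ⟩
  count (λ x → ⌊ fsuc x ≟ᶠ fsuc x₀ ⌋) (allFin k) ≡⟨ count-cong (λ x → ⌊⌋-map′ (cong fsuc) suc-injective (x ≟ᶠ x₀)) (allFin k) ⟩
  count (λ x → ⌊ x ≟ᶠ x₀ ⌋) (allFin k)           ≡⟨ count-≟-allFin x₀ ⟩
  1                                              ∎
  where open ≡-Reasoning

module _ {X Y : Set} (_≟_ : DecidableEquality X) where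
  open Fibres _≟_ {Y}

  count-fibre-cartesianProduct : ∀ x₀ xs (ys : List Y) →
    count (fibre x₀) (cartesianProduct xs ys) ≡ count (λ x → ⌊ x ≟ x₀ ⌋) xs * length ys
  count-fibre-cartesianProduct x₀ []       ys = refl
  count-fibre-cartesianProduct x₀ (x ∷ xs) ys = begin
    count (fibre x₀) (map (x ,_) ys ++ cartesianProduct xs ys)
      ≡⟨ count-++ (fibre x₀) (map (x ,_) ys) _ ⟩
    count (fibre x₀) (map (x ,_) ys) + count (fibre x₀) (cartesianProduct xs ys)
      ≡⟨ cong₂ _+_ (trans (count-map (fibre x₀) (x ,_) ys) (count-const ⌊ x ≟ x₀ ⌋ ys))
                   (count-fibre-cartesianProduct x₀ xs ys) ⟩
    indicator ⌊ x ≟ x₀ ⌋ * length ys + count (λ x → ⌊ x ≟ x₀ ⌋) xs * length ys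
      ≡⟨ *-distribʳ-+ (length ys) (indicator ⌊ x ≟ x₀ ⌋) _ ⟨
    count (λ x → ⌊ x ≟ x₀ ⌋) (x ∷ xs) * length ys ∎
    where open ≡-Reasoning

concatMap-row≡cartesianProduct : ∀ {A B : Set} (xs : List A) (ys : List B) →
  concatMap (λ x → map (x ,_) ys) xs ≡ cartesianProduct xs ys
concatMap-row≡cartesianProduct []       ys = refl
concatMap-row≡cartesianProduct (x ∷ xs) ys = cong (map (x ,_) ys ++_) (concatMap-row≡cartesianProduct xs ys)

module _ {m n : ℕ} where
  open Fibres (_≟ᶠ_ {m}) {Fin n}

  card≡count : ∀ (S : Subset (Fin m × Fin n)) → card S ≡ count S (cartesianProduct (allFin m) (allFin n))
  card≡count S = cong (count S) (concatMap-row≡cartesianProduct (allFin m) (allFin n))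

  card-fibre : ∀ x₀ → card (fibre x₀) ≡ n
  card-fibre x₀ = begin
    card (fibre x₀)                                              ≡⟨ card≡count (fibre x₀) ⟩
    count (fibre x₀) (cartesianProduct (allFin m) (allFin n))    ≡⟨ count-fibre-cartesianProduct _≟ᶠ_ x₀ (allFin m) (allFin n) ⟩
    count (λ x → ⌊ x ≟ᶠ x₀ ⌋) (allFin m) * length (allFin n)     ≡⟨ cong₂ _*_ (count-≟-allFin x₀) (length-tabulate (λ y → y)) ⟩
    1 * n                                                        ≡⟨ *-identityˡ n ⟩
    n                                                            ∎
    where open ≡-Reasoning

  ⊆-card-≡⇒≐ : ∀ {S T : Subset (Fin m × Fin n)} → S ⊆ T → card S ≡ card T → S ≐ T
  ⊆-card-≡⇒≐ {S} {T} S⊆T card≡ = ⊆-antisym S⊆T λ z →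
    count-≡⇒⊇ S⊆T (trans (sym (card≡count S)) (trans card≡ (card≡count T))) z
      (∈-cartesianProduct⁺ (∈-allFin (proj₁ z)) (∈-allFin (proj₂ z)))

  module _ (G : PermGroup (Fin m)) (H : PermGroup (Fin n)) (trH : Transitive H)
           {B : Subset (Fin m × Fin n)} (B-block : IsBlock (G ≀ H) B)
           {x₀ : Fin m} {y₀ : Fin n} (B∋₀ : B (x₀ , y₀) ≡ true) where

    block⊆fibre⊎fibre⊆block : B ⊆ fibre x₀ ⊎ fibre x₀ ⊆ B
    block⊆fibre⊎fibre⊆block
      with any? (λ x → any? λ y → (B (x , y) Bool.≟ true) ×-dec ¬? (x ≟ᶠ x₀))
    ... | yes (x₁ , y₁ , B∋₁ , x₁≢x₀) = inj₂ (fibre⊆block G H trH B-block B∋₀ B∋₁ x₁≢x₀)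
    ... | no ∄x₁≢x₀ = inj₁ λ (x , y) B∋ → fibre-∋ {z = x , y}
      (decidable-stable (x ≟ᶠ x₀) λ x≢x₀ → ∄x₁≢x₀ (x , y , B∋ , x≢x₀))

    card-n⇒block≐fibre : card B ≡ n → B ≐ fibre x₀
    card-n⇒block≐fibre card-B with block⊆fibre⊎fibre⊆block
    ... | inj₁ B⊆F = ⊆-card-≡⇒≐ B⊆F (trans card-B (sym (card-fibre x₀)))
    ... | inj₂ F⊆B = ≐-sym (⊆-card-≡⇒≐ F⊆B (trans (card-fibre x₀) (sym card-B)))

mainTheorem1 : (m n : ℕ) (G : PermGroup (Fin m)) (H : PermGroup (Fin n)) →
    Transitive G → Transitive H →
    ((C : Family (Fin m × Fin n)) → IsInvariantPartition (G ≀ H) C →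
        (fibres m n ⪯ C) ⊎ (C ⪯ fibres m n))
    × ((C : Family (Fin m × Fin n)) → IsInvariantPartition (G ≀ H) C →
        (∀ S → C S → card S ≡ n) → C ≡ₚ fibres m n)
mainTheorem1 m n G H trG trH = comparable , unique
  where
  open Fibres (_≟ᶠ_ {m}) {Fin n}

  comparable : (C : Family (Fin m × Fin n)) → IsInvariantPartition (G ≀ H) C →
    (fibres m n ⪯ C) ⊎ (C ⪯ fibres m n)
  comparable C (B , (_ , B∋₀) , B-block , C-orbit)
    with block⊆fibre⊎fibre⊆block G H trH B-block B∋₀
  ... | inj₁ B⊆F = inj₂ (⊆fibre⇒⪯fibrePartition G H C-orbit B⊆F)
  ... | inj₂ F⊆B = inj₁ (fibre⊆⇒fibrePartition⪯ G H C-orbit trG F⊆B)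

  unique : (C : Family (Fin m × Fin n)) → IsInvariantPartition (G ≀ H) C →
    (∀ S → C S → card S ≡ n) → C ≡ₚ fibres m n
  unique C (B , (_ , B∋₀) , B-block , C-orbit) card-n =
    ≐fibre⇒≡ₚfibrePartition G H C-orbit trG (card-n⇒block≐fibre G H trH B-block B∋₀ card-B)
    where
    card-B : card B ≡ n
    card-B = card-n B (proj₂ (C-orbit B) (↔-id _ , ≀-id G H , λ _ → refl))
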